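{- Let $A>B\geq 2$ be positive integers and let $k\geq 1$ be a fixed integer. Then there are only finitely many sets $Q=\{q_1,\dots,q_k\}$ of $k$ distinct primes with $2,3\notin Q$ satisfying $$A\cdot \prod_{i=1}^k (q_i-1) = B\cdot \prod_{i=1}^k q_i + 2.$$ -}

module Defs where

open import Data.Nat using (ℕ; _<_; _*_; _∸_)
open import Data.Vec using (Vec; []; _∷_; foldr)
open import Data.Product using (_×_)
open import Data.Unit using (⊤)

-- A k-element set of naturals is represented canonically by the
-- strictly increasing vector listing its elements.
StrictlyIncreasing : ∀ {k} → Vec ℕ k → Set
StrictlyIncreasing [] = ⊤
StrictlyIncreasing (x ∷ []) = ⊤
StrictlyIncreasing (x ∷ y ∷ xs) = x < y × StrictlyIncreasing (y ∷ xs)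

prodV : ∀ {k} → Vec ℕ k → ℕ
prodV = foldr _ _*_ 1

-- ∏ (q_i - 1)   (all q_i are primes, so q_i ≥ 2 and ∸ is ordinary subtraction)
prodPred : ∀ {k} → Vec ℕ k → ℕ
prodPred = foldr _ (λ q r → (q ∸ 1) * r) 1

-- Write a = q₁ − 1 for the smallest element of Q. Every q ∈ Q exceeds a, so
-- ∏ q/(q−1) ≤ (1 + 1/a)ᵏ ≤ 1 + (2ᵏ − 1)/a, while the equation forces A > B and hence
-- (B + 1) ∏ (q−1) ≤ B ∏ q + 2. Together these give a ≤ (2ᵏ − 1) B + 2. Removing q₁
-- leaves a solution of the same equation with (A, B) replaced by (A (q₁ − 1), B q₁), so
-- bounding the remaining entries one at a time bounds all of Q.
module Submission where

open import Defs
open import Data.Nat using (ℕ; _<_; _≤_; _*_; _+_)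
open import Data.Vec using (Vec)
open import Data.Nat.Primality using (Prime)
open import Data.Vec.Relation.Unary.All using (All)
open import Data.List using (List)
open import Data.List.Membership.Propositional using (_∈_)
open import Data.Product using (_×_; ∃)
open import Relation.Binary.PropositionalEquality using (_≡_; _≢_)

open import Data.Nat using (zero; suc; _∸_; _⊔_; s≤s; z≤n)
open import Data.Nat.Base using (nonTrivial⇒n>1; >-nonZero)
open import Data.Nat.Properties
open import Data.Nat.Primality using (prime⇒nonTrivial)
open import Data.Nat.Tactic.RingSolver using (solve)
open import Function using (_∋_)
open import Algebra.Properties.CommutativeSemigroup *-commutativeSemigroup using (x∙yz≈y∙xz)
open import Data.Vec using ([]; _∷_)
open import Data.Vec.Relation.Unary.All using ([]; _∷_) renaming (map to All-map)
open import Data.List using ([]; _∷_; upTo; cartesianProductWith)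
open import Data.List.Membership.Propositional.Properties using (∈-cartesianProductWith⁺; ∈-upTo⁺)
open import Data.List.Relation.Unary.Any using (here)
open import Data.Product using (_,_)
open import Data.Unit using (tt)
open import Relation.Binary.PropositionalEquality using (refl; sym; cong; module ≡-Reasoning)

mersenne : ℕ → ℕ
mersenne zero    = 0
mersenne (suc n) = 2 * mersenne n + 1

prodPred≤prodV : ∀ {n} (s : Vec ℕ n) → prodPred s ≤ prodV s
prodPred≤prodV []      = ≤-refl
prodPred≤prodV (q ∷ s) = *-mono-≤ (m∸n≤m q 1) (prodPred≤prodV s)

prodPred-positive : ∀ {n} {s : Vec ℕ n} → All (1 <_) s → 1 ≤ prodPred s
prodPred-positive []                 = ≤-refl
prodPred-positive (s≤s 1≤q-1 ∷ 1<s) = *-mono-≤ 1≤q-1 (prodPred-positive 1<s)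

-- In ratio form: q/(q−1) · (a+d)/a ≤ (a+2d+1)/a.
factor-ratio-≤ : ∀ {a d q} → 1 ≤ a → a < q → q * (a + d) ≤ (a + (2 * d + 1)) * (q ∸ 1)
factor-ratio-≤ {suc f} {d} {suc y} _ (s≤s a≤y) with (e , refl) ← m≤n⇒∃[o]m+o≡n a≤y = begin
  suc (suc f + e) * (suc f + d)                        ≤⟨ m≤m+n _ (d * (f + e) + e) ⟩
  suc (suc f + e) * (suc f + d) + (d * (f + e) + e)    ≡⟨ solve (List ℕ ∋ f ∷ e ∷ d ∷ []) ⟩
  (suc f + (2 * d + 1)) * (suc f + e)                  ∎
  where open ≤-Reasoning

prodV-ratio-≤ : ∀ {n a} (s : Vec ℕ n) → 1 ≤ a → All (a <_) s →
                a * prodV s ≤ (a + mersenne n) * prodPred s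
prodV-ratio-≤ {zero}  {a} []      _   []          = ≤-reflexive (cong (_* 1) (sym (+-identityʳ a)))
prodV-ratio-≤ {suc n} {a} (q ∷ s) 1≤a (a<q ∷ a<s) = begin
  a * (q * P)                       ≡⟨ x∙yz≈y∙xz a q P ⟩
  q * (a * P)                       ≤⟨ *-monoʳ-≤ q (prodV-ratio-≤ s 1≤a a<s) ⟩
  q * ((a + d) * R)                 ≡⟨ sym (*-assoc q (a + d) R) ⟩
  q * (a + d) * R                   ≤⟨ *-monoˡ-≤ R (factor-ratio-≤ 1≤a a<q) ⟩
  (a + (2 * d + 1)) * (q ∸ 1) * R   ≡⟨ *-assoc (a + (2 * d + 1)) (q ∸ 1) R ⟩
  (a + (2 * d + 1)) * ((q ∸ 1) * R) ∎
  where
  open ≤-Reasoning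
  P = prodV s
  R = prodPred s
  d = mersenne n

solution⇒M<N : ∀ N M {R P} → R ≤ P → N * R ≡ M * P + 2 → M < N
solution⇒M<N N M {R} {P} R≤P eq = ≰⇒> λ N≤M →
  <⇒≱ (m<m+n (M * P) (s≤s z≤n)) (begin
    M * P + 2 ≡⟨ sym eq ⟩
    N * R     ≤⟨ *-mono-≤ N≤M R≤P ⟩
    M * P     ∎)
  where open ≤-Reasoning

ratio-bound : ∀ {a d M N R P} → 1 ≤ a → a ≤ R → R ≤ P → a * P ≤ (a + d) * R →
              N * R ≡ M * P + 2 → a ≤ M * d + 2
ratio-bound {a} {d} {M} {N} {R} {P} 1≤a a≤R R≤P ratio eq =
  *-cancelʳ-≤ a (M * d + 2) R {{>-nonZero (≤-trans 1≤a a≤R)}}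
    (+-cancelˡ-≤ (a * M * R) (a * R) ((M * d + 2) * R) (begin
      a * M * R + a * R         ≡⟨ solve (List ℕ ∋ a ∷ M ∷ R ∷ []) ⟩
      a * (suc M * R)           ≤⟨ *-monoʳ-≤ a (*-monoˡ-≤ R (solution⇒M<N N M R≤P eq)) ⟩
      a * (N * R)               ≡⟨ cong (a *_) eq ⟩
      a * (M * P + 2)           ≡⟨ solve (List ℕ ∋ a ∷ M ∷ P ∷ []) ⟩
      M * (a * P) + 2 * a       ≤⟨ +-mono-≤ (*-monoʳ-≤ M ratio) (*-monoʳ-≤ 2 a≤R) ⟩
      M * ((a + d) * R) + 2 * R ≡⟨ solve (List ℕ ∋ M ∷ a ∷ d ∷ R ∷ []) ⟩
      a * M * R + (M * d + 2) * R ∎))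
  where open ≤-Reasoning

headBound : ℕ → ℕ → ℕ
headBound n M = M * mersenne n + 3

head-≤ : ∀ N M {n q} {t : Vec ℕ n} → 2 ≤ q → All (q ≤_) t →
         N * prodPred (q ∷ t) ≡ M * prodV (q ∷ t) + 2 → q ≤ headBound (suc n) M
head-≤ N M {n} {suc a} {t} (s≤s 1≤a) a<t eq =
  ≤-trans (s≤s (ratio-bound {M = M} {N} 1≤a a≤R (prodPred≤prodV (suc a ∷ t)) ratio eq))
          (≤-reflexive (sym (+-suc (M * mersenne (suc n)) 2)))
  where
  a≤R : a ≤ a * prodPred t
  a≤R = m≤m*n a (prodPred t) {{>-nonZero (prodPred-positive (All-map (≤-trans (s≤s 1≤a)) a<t))}}
  ratio : a * prodV (suc a ∷ t) ≤ (a + mersenne (suc n)) * prodPred (suc a ∷ t)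
  ratio = prodV-ratio-≤ (suc a ∷ t) 1≤a (≤-refl ∷ a<t)

entryBound : ℕ → ℕ → ℕ
entryBound zero    M = 0
entryBound (suc n) M = headBound (suc n) M ⊔ entryBound n (M * headBound (suc n) M)

entryBound-monoʳ-≤ : ∀ n {M M′} → M ≤ M′ → entryBound n M ≤ entryBound n M′
entryBound-monoʳ-≤ zero    _    = ≤-refl
entryBound-monoʳ-≤ (suc n) M≤M′ = ⊔-mono-≤ head≤ (entryBound-monoʳ-≤ n (*-mono-≤ M≤M′ head≤))
  where head≤ = +-monoˡ-≤ 3 (*-monoˡ-≤ (mersenne (suc n)) M≤M′)

StrictlyIncreasing-tail : ∀ {n q} {t : Vec ℕ n} → StrictlyIncreasing (q ∷ t) → StrictlyIncreasing t
StrictlyIncreasing-tail {t = []}    _        = tt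
StrictlyIncreasing-tail {t = _ ∷ _} (_ , si) = si

StrictlyIncreasing⇒head< : ∀ {n q} {t : Vec ℕ n} → StrictlyIncreasing (q ∷ t) → All (q <_) t
StrictlyIncreasing⇒head< {t = []}    _          = []
StrictlyIncreasing⇒head< {t = _ ∷ _} (q<r , si) = q<r ∷ All-map (<-trans q<r) (StrictlyIncreasing⇒head< si)

entries-≤ : ∀ N M {n} (s : Vec ℕ n) → StrictlyIncreasing s → All (2 ≤_) s →
            N * prodPred s ≡ M * prodV s + 2 → All (_≤ entryBound n M) s
entries-≤ N M []      _  _          _  = []
entries-≤ N M {suc n} (q ∷ t) si (2≤q ∷ 2≤t) eq =
  ≤-trans q≤ (m≤m⊔n _ _) ∷
  All-map (λ r≤ → ≤-trans r≤ tail-bound≤)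
          (entries-≤ (N * (q ∸ 1)) (M * q) t (StrictlyIncreasing-tail si) 2≤t eq′)
  where
  q≤ : q ≤ headBound (suc n) M
  q≤ = head-≤ N M 2≤q (All-map <⇒≤ (StrictlyIncreasing⇒head< si)) eq
  tail-bound≤ : entryBound n (M * q) ≤ entryBound (suc n) M
  tail-bound≤ = ≤-trans (entryBound-monoʳ-≤ n (*-monoʳ-≤ M q≤)) (m≤n⊔m _ _)
  eq′ : N * (q ∸ 1) * prodPred t ≡ M * q * prodV t + 2
  eq′ = begin
    N * (q ∸ 1) * prodPred t   ≡⟨ *-assoc N (q ∸ 1) (prodPred t) ⟩
    N * prodPred (q ∷ t)       ≡⟨ eq ⟩
    M * prodV (q ∷ t) + 2      ≡⟨ cong (_+ 2) (sym (*-assoc M q (prodV t))) ⟩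
    M * q * prodV t + 2        ∎
    where open ≡-Reasoning

vecsBoundedBy : ℕ → (k : ℕ) → List (Vec ℕ k)
vecsBoundedBy N zero    = [] ∷ []
vecsBoundedBy N (suc k) = cartesianProductWith _∷_ (upTo (suc N)) (vecsBoundedBy N k)

∈-vecsBoundedBy : ∀ {N k} (v : Vec ℕ k) → All (_≤ N) v → v ∈ vecsBoundedBy N k
∈-vecsBoundedBy []      []         = here refl
∈-vecsBoundedBy (x ∷ v) (x≤ ∷ v≤) = ∈-cartesianProductWith⁺ _∷_ (∈-upTo⁺ (s≤s x≤)) (∈-vecsBoundedBy v v≤)

prime⇒2≤ : ∀ {p} → Prime p → 2 ≤ p
prime⇒2≤ {p} pr = nonTrivial⇒n>1 p {{prime⇒nonTrivial pr}}

-- Finiteness needs none of B < A, 2 ≤ B, 1 ≤ k or 2, 3 ∉ Q.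
lemma7 : (A B k : ℕ) → B < A → 2 ≤ B → 1 ≤ k →
    ∃ λ (L : List (Vec ℕ k)) →
      (Q : Vec ℕ k) → StrictlyIncreasing Q → All Prime Q →
        All (λ q → q ≢ 2 × q ≢ 3) Q →
        A * prodPred Q ≡ B * prodV Q + 2 →
        Q ∈ L
lemma7 A B k _ _ _ = vecsBoundedBy (entryBound k B) k ,
  λ Q si primes _ eq → ∈-vecsBoundedBy Q (entries-≤ A B Q si (All-map prime⇒2≤ primes) eq)
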